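{- Let $k$ be a nonnegative integer. In every connected graph $G$ with $\Delta(G)\geq k+2$ there exists a minimum $k$-power dominating set $S$ in which every vertex has at least $k+1$ external $S$-private neighbors.
   Context: Graphs are finite, simple and undirected; $\Delta(G)$ is the maximum degree. For $S\subseteq V$ and $v\in S$, an $S$-private neighbor of $v$ is a vertex $x\in N(v)$ with $x\notin N(S\setminus\{v\})$; it is external if moreover $x\notin S$. For a graph $G=(V,E)$, nonnegative integer $k$ and $S\subseteq V$, define $\mathscr P^0_{G,k}(S)=N[S]$ and $\mathscr P^{i+1}_{G,k}(S)=\mathscr P^i_{G,k}(S)\cup\bigcup\{N(v): v\in \mathscr P^i_{G,k}(S),\ 1\le |N(v)\setminus \mathscr P^i_{G,k}(S)|\le k\}$. $S$ is a $k$-power dominating set of $G$ if $\mathscr P^\ell_{G,k}(S)=V$ for some $\ell$; a minimum one has smallest cardinality. -}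

module Defs where

open import Data.Nat using (ℕ; zero; suc; _+_; _≤_)
open import Data.Bool using (Bool; true; false; _∧_; _∨_; not)
open import Data.Fin using (Fin; zero; suc; _≟_)
open import Data.Vec using (tabulate; lookup)
open import Data.Fin.Subset using (Subset; ∣_∣; _─_; ⊤)
open import Data.Product using (Σ; ∃; _×_; _,_)
open import Relation.Nullary.Decidable using (⌊_⌋)
open import Relation.Binary.PropositionalEquality using (_≡_)

record Graph (n : ℕ) : Set where
  field
    adj   : Fin n → Fin n → Bool
    sym   : ∀ u v → adj u v ≡ adj v u
    irrefl : ∀ v → adj v v ≡ false
open Graph public

anyᶠ : ∀ {n} → (Fin n → Bool) → Bool
anyᶠ {zero} f = false
anyᶠ {suc n} f = f zero ∨ anyᶠ (λ i → f (suc i))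

module _ {n : ℕ} (G : Graph n) where

  N : Fin n → Subset n
  N v = tabulate (adj G v)

  NS : Subset n → Subset n
  NS S = tabulate (λ x → anyᶠ (λ u → lookup S u ∧ adj G u x))

  NC : Subset n → Subset n
  NC S = tabulate (λ x → lookup S x ∨ lookup (NS S) x)

  deg : Fin n → ℕ
  deg v = ∣ N v ∣

  MaxDegAtLeast : ℕ → Set
  MaxDegAtLeast m = ∃ λ v → m ≤ deg v

  data Walk : Fin n → Fin n → Set where
    here : ∀ {v} → Walk v v
    step : ∀ {u v w} → adj G u v ≡ true → Walk v w → Walk u w

  Connected : Set
  Connected = ∀ u v → Walk u v

  between1 : ℕ → ℕ → Bool
  between1 zero k = false
  between1 (suc m) zero = false
  between1 (suc zero) (suc k) = true
  between1 (suc (suc m)) (suc k) = between1 (suc m) k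

  propStep : ℕ → Subset n → Subset n
  propStep k P = tabulate (λ x → lookup P x ∨
    anyᶠ (λ v → lookup P v ∧ adj G v x ∧ between1 ∣ N v ─ P ∣ k))

  𝒫 : ℕ → ℕ → Subset n → Subset n
  𝒫 k zero S = NC S
  𝒫 k (suc i) S = propStep k (𝒫 k i S)

  IsPowerDom : ℕ → Subset n → Set
  IsPowerDom k S = ∃ λ ℓ → 𝒫 k ℓ S ≡ ⊤

  IsMinPowerDom : ℕ → Subset n → Set
  IsMinPowerDom k S = IsPowerDom k S × (∀ T → IsPowerDom k T → ∣ S ∣ ≤ ∣ T ∣)

  EPN : Subset n → Fin n → Subset n
  EPN S v = tabulate (λ x → adj G v x ∧ not (lookup S x) ∧
    not (anyᶠ (λ u → lookup S u ∧ not ⌊ u ≟ v ⌋ ∧ adj G u x)))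

-- Take a k-power dominating set S minimising, lexicographically, its size, its number of vertices
-- without a neighbour in S, and its number of vertices of degree below k + 2. The neighbours of
-- x ∈ S unobserved by S - x are exactly its external private neighbours, so if there are at most k
-- of them, x forces them as soon as S - x (plus one token) observes x. Then: if S - x observes x,
-- drop x; otherwise x is isolated in S, and if some neighbour y of x is observed by S - x, move the
-- token from x to y, which leaves one isolated vertex fewer; otherwise all neighbours of x are
-- private, so deg x ≤ k, and the token can be slid along a path to a vertex of degree ≥ k + 2,
-- each vertex passed having degree ≤ k + 1 and hence forcing its neighbours once its successor
-- holds the token. Each case yields a k-power dominating set that is smaller in this order.

module Submission where

open import Defs hiding (sym)
open import Data.Bool using (Bool; true; false; _∧_; _∨_; not)
open import Data.Bool.Properties using (∨-zeroʳ; ∧-conicalˡ; ∧-conicalʳ; ¬-not) renaming (_≟_ to _≟ᵇ_)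
open import Data.Fin using (Fin; zero; suc; _≟_)
open import Data.Fin.Subset
open import Data.Fin.Subset.Properties
import Data.Nat as Nat
open import Data.Nat using (ℕ; zero; suc; _+_; _≤_; _<_; z≤n; s≤s; _<?_; _≤?_)
open import Data.Nat.Induction using (<-wellFounded)
open import Data.Nat.Properties
  using (≤-trans; ≤-antisym; ≤-<-trans; +-comm; +-suc; +-monoʳ-≤; n≤1+n; m≤n⇒m<n∨m≡n;
         m<1+n⇒m≤n; +-cancelʳ-≤; m<m+n; <⇒≱; ≰⇒>; ≮⇒≥; module ≤-Reasoning)
open import Data.Product using (∃; _×_; _,_; proj₁; proj₂)
open import Data.Product.Relation.Binary.Lex.Strict using (×-Lex; ×-wellFounded; ×-decidable)
open import Data.Sum using (_⊎_; inj₁; inj₂)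
open import Data.Vec using (_∷_; []; lookup; tabulate; here; there)
open import Data.Vec.Properties
  using (lookup⇒[]=; []=⇒lookup; lookup∘tabulate; tabulate∘lookup; tabulate-cong; lookup-zipWith; ≡-dec)
open import Function using (_∘_; id)
open import Induction.WellFounded using (WellFounded; Acc; acc)
open import Level using (0ℓ)
open import Relation.Binary using (Rel; Decidable)
import Relation.Binary.Construct.On as On
open import Relation.Nullary using (Dec; yes; no; ¬_; contradiction)
open import Relation.Nullary.Decidable using (⌊_⌋; _×-dec_; map′; decidable-stable)
open import Relation.Binary.PropositionalEquality
  using (_≡_; _≢_; refl; sym; trans; cong; cong₂; subst; module ≡-Reasoning)

private
  variable
    n : ℕ
    p q r : Subset n
    x y z : Fin n

x∈p─q⇒x∉q : ∀ (p q : Subset n) → x ∈ p ─ q → x ∉ q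
x∈p─q⇒x∉q (_ ∷ p) (inside ∷ q) () here
x∈p─q⇒x∉q (_ ∷ p) (_ ∷ q) (there x∈p─q) (there x∈q) = x∈p─q⇒x∉q p q x∈p─q x∈q

q⊆r⇒p─r⊆p─q : q ⊆ r → p ─ r ⊆ p ─ q
q⊆r⇒p─r⊆p─q {r = r} {p = p} q⊆r x∈p─r =
  x∈p∧x∉q⇒x∈p─q (p─q⊆p p r x∈p─r) (x∈p─q⇒x∉q p r x∈p─r ∘ q⊆r)

q⊆r⇒∣p─r∣≤∣p─q∣ : ∀ p → q ⊆ r → ∣ p ─ r ∣ ≤ ∣ p ─ q ∣
q⊆r⇒∣p─r∣≤∣p─q∣ p q⊆r = p⊆q⇒∣p∣≤∣q∣ (q⊆r⇒p─r⊆p─q {p = p} q⊆r)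

p⊆q⇒p∪r⊆q∪r : p ⊆ q → p ∪ r ⊆ q ∪ r
p⊆q⇒p∪r⊆q∪r {p = p} {r = r} p⊆q x∈p∪r with x∈p∪q⁻ p r x∈p∪r
... | inj₁ x∈p = x∈p∪q⁺ (inj₁ (p⊆q x∈p))
... | inj₂ x∈r = x∈p∪q⁺ (inj₂ x∈r)

p⊆p-x∪⁅x⁆ : p ⊆ (p - x) ∪ ⁅ x ⁆
p⊆p-x∪⁅x⁆ {x = x} {y} y∈p with y ≟ x
... | yes refl = x∈p∪q⁺ (inj₂ (x∈⁅x⁆ x))
... | no y≢x   = x∈p∪q⁺ (inj₁ (x∈p∧x≢y⇒x∈p-y y∈p y≢x))

x∈p⇒⁅x⁆⊆p : x ∈ p → ⁅ x ⁆ ⊆ p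
x∈p⇒⁅x⁆⊆p {x = x} {p = p} x∈p y∈⁅x⁆ = subst (_∈ p) (sym (x∈⁅y⁆⇒x≡y x y∈⁅x⁆)) x∈p

∣p∪q∣≤∣p∣+∣q∣ : ∀ (p q : Subset n) → ∣ p ∪ q ∣ ≤ ∣ p ∣ + ∣ q ∣
∣p∪q∣≤∣p∣+∣q∣ []            []            = z≤n
∣p∪q∣≤∣p∣+∣q∣ (outside ∷ p) (outside ∷ q) = ∣p∪q∣≤∣p∣+∣q∣ p q
∣p∪q∣≤∣p∣+∣q∣ (outside ∷ p) (inside  ∷ q) =
  subst (suc ∣ p ∪ q ∣ ≤_) (sym (+-suc ∣ p ∣ ∣ q ∣)) (s≤s (∣p∪q∣≤∣p∣+∣q∣ p q))
∣p∪q∣≤∣p∣+∣q∣ (inside  ∷ p) (outside ∷ q) = s≤s (∣p∪q∣≤∣p∣+∣q∣ p q)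
∣p∪q∣≤∣p∣+∣q∣ (inside  ∷ p) (inside  ∷ q) =
  s≤s (≤-trans (∣p∪q∣≤∣p∣+∣q∣ p q) (+-monoʳ-≤ ∣ p ∣ (n≤1+n ∣ q ∣)))

p⊆q-x⇒∣p∣<∣q∣ : x ∈ q → p ⊆ q - x → ∣ p ∣ < ∣ q ∣
p⊆q-x⇒∣p∣<∣q∣ x∈q p⊆q-x = ≤-<-trans (p⊆q⇒∣p∣≤∣q∣ p⊆q-x) (x∈p⇒∣p-x∣<∣p∣ x∈q)

p⊆q-x∪⁅y⁆⇒∣p∣≤∣q∣ : x ∈ q → p ⊆ (q - x) ∪ ⁅ y ⁆ → ∣ p ∣ ≤ ∣ q ∣
p⊆q-x∪⁅y⁆⇒∣p∣≤∣q∣ {x = x} {q = q} {p = p} {y = y} x∈q p⊆ = begin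
  ∣ p ∣                  ≤⟨ p⊆q⇒∣p∣≤∣q∣ p⊆ ⟩
  ∣ (q - x) ∪ ⁅ y ⁆ ∣    ≤⟨ ∣p∪q∣≤∣p∣+∣q∣ (q - x) ⁅ y ⁆ ⟩
  ∣ q - x ∣ + ∣ ⁅ y ⁆ ∣  ≡⟨ cong (∣ q - x ∣ +_) (∣⁅x⁆∣≡1 y) ⟩
  ∣ q - x ∣ + 1          ≡⟨ +-comm ∣ q - x ∣ 1 ⟩
  suc ∣ q - x ∣          ≤⟨ x∈p⇒∣p-x∣<∣p∣ x∈q ⟩
  ∣ q ∣                  ∎
  where open ≤-Reasoning

p⊆q⇒p≡q⊎∣p∣<∣q∣ : p ⊆ q → p ≡ q ⊎ ∣ p ∣ < ∣ q ∣
p⊆q⇒p≡q⊎∣p∣<∣q∣ {p = p} {q = q} p⊆q with p ⊂? q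
... | yes p⊂q = inj₂ (p⊂q⇒∣p∣<∣q∣ p⊂q)
... | no  p⊄q = inj₁ (⊆-antisym p⊆q q⊆p)
  where
  q⊆p : q ⊆ p
  q⊆p {x} x∈q = decidable-stable (x ∈? p) (λ x∉p → p⊄q (p⊆q , x , x∈q , x∉p))

∈-tabulate⁺ : ∀ {f : Fin n → Bool} → f x ≡ true → x ∈ tabulate f
∈-tabulate⁺ {x = x} {f = f} fx = lookup⇒[]= x (tabulate f) (trans (lookup∘tabulate f x) fx)

∈-tabulate⁻ : ∀ {f : Fin n → Bool} → x ∈ tabulate f → f x ≡ true
∈-tabulate⁻ {x = x} {f = f} x∈ = trans (sym (lookup∘tabulate f x)) ([]=⇒lookup x∈)

tabulate-∨ : ∀ (p : Subset n) (f : Fin n → Bool) → tabulate (λ x → lookup p x ∨ f x) ≡ p ∪ tabulate f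
tabulate-∨ p f = begin
  tabulate (λ x → lookup p x ∨ f x)  ≡⟨ tabulate-cong lookup-∪ ⟩
  tabulate (lookup (p ∪ tabulate f))  ≡⟨ tabulate∘lookup (p ∪ tabulate f) ⟩
  p ∪ tabulate f                      ∎
  where
  open ≡-Reasoning
  lookup-∪ : ∀ x → lookup p x ∨ f x ≡ lookup (p ∪ tabulate f) x
  lookup-∪ x =
    sym (trans (lookup-zipWith _∨_ x p (tabulate f)) (cong (lookup p x ∨_) (lookup∘tabulate f x)))

anyᶠ⁺ : ∀ (f : Fin n → Bool) x → f x ≡ true → anyᶠ f ≡ true
anyᶠ⁺ f zero    fx rewrite fx = refl
anyᶠ⁺ f (suc x) fx = trans (cong (f zero ∨_) (anyᶠ⁺ (f ∘ suc) x fx)) (∨-zeroʳ (f zero))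

anyᶠ⁻ : ∀ (f : Fin n → Bool) → anyᶠ f ≡ true → ∃ λ x → f x ≡ true
anyᶠ⁻ {suc n} f any-f with f zero in f0
... | true  = zero , f0
... | false with anyᶠ⁻ (f ∘ suc) any-f
...   | x , fx = suc x , fx

⌊⌋-true⁺ : ∀ {a} {A : Set a} (a? : Dec A) → A → ⌊ a? ⌋ ≡ true
⌊⌋-true⁺ (yes _) _ = refl
⌊⌋-true⁺ (no ¬a) a = contradiction a ¬a

⌊⌋-true⁻ : ∀ {a} {A : Set a} (a? : Dec A) → ⌊ a? ⌋ ≡ true → A
⌊⌋-true⁻ (yes a) _ = a

m<n<o+2⇒m≤o : ∀ {m n o} → m < n → n < o + 2 → m ≤ o
m<n<o+2⇒m≤o {m} {n} {o} m<n n<o+2 =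
  +-cancelʳ-≤ 2 m o (subst (_≤ o + 2) (+-comm 2 m) (≤-trans (s≤s m<n) n<o+2))

not⌊≟⌋⇒≢ : ∀ {u v : Fin n} → not ⌊ u ≟ v ⌋ ≡ true → u ≢ v
not⌊≟⌋⇒≢ {u = u} {v} _ with u ≟ v
not⌊≟⌋⇒≢ () | yes _
not⌊≟⌋⇒≢ _  | no u≢v = u≢v

module IncreasingChain (P : ℕ → Subset n) (P-increasing : ∀ i → P i ⊆ P (suc i))
                       (P-next : ∀ {i j} → P i ≡ P j → P (suc i) ≡ P (suc j)) where

  P-mono : ∀ i d → P i ⊆ P (d + i)
  P-mono i zero    = id
  P-mono i (suc d) = P-increasing (d + i) ∘ P-mono i d

  P-constant : ∀ j → P j ≡ P (suc j) → ∀ d → P (d + j) ≡ P j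
  P-constant j eq zero    = refl
  P-constant j eq (suc d) = trans (P-next (P-constant j eq d)) (sym eq)

  P-grows : ∀ i → i ≤ ∣ P i ∣ ⊎ P i ≡ P (suc i)
  P-grows zero = inj₁ z≤n
  P-grows (suc i) with P-grows i
  ... | inj₂ eq = inj₂ (P-next eq)
  ... | inj₁ i≤∣Pi∣ with p⊆q⇒p≡q⊎∣p∣<∣q∣ (P-increasing i)
  ...   | inj₁ eq = inj₂ (P-next eq)
  ...   | inj₂ lt = inj₁ (≤-<-trans i≤∣Pi∣ lt)

  ⊤-by-step-n : ∀ ℓ → P ℓ ≡ ⊤ → P n ≡ ⊤
  ⊤-by-step-n ℓ Pℓ≡⊤ with P-grows n
  ... | inj₁ n≤∣Pn∣ = ∣p∣≡n⇒p≡⊤ (≤-antisym (∣p∣≤n (P n)) n≤∣Pn∣)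
  ... | inj₂ eq = ⊆-antisym ⊆⊤ (subst (_⊆ P n) Pℓ≡⊤ Pℓ⊆Pn)
    where
    Pℓ⊆Pn : P ℓ ⊆ P n
    Pℓ⊆Pn = subst (P ℓ ⊆_) (trans (cong P (+-comm n ℓ)) (P-constant n eq ℓ)) (P-mono ℓ n)

module _ {a ℓ p} {A : Set a} {_≺_ : Rel A ℓ} (≺-wellFounded : WellFounded _≺_) {P : A → Set p}
         (smaller? : ∀ x → Dec (∃ λ y → P y × y ≺ x)) where

  ≺-minimal : ∀ {x} → P x → ∃ λ m → P m × (∀ {y} → P y → ¬ y ≺ m)
  ≺-minimal {x} = descend (≺-wellFounded x)
    where
    descend : ∀ {x} → Acc _≺_ x → P x → ∃ λ m → P m × (∀ {y} → P y → ¬ y ≺ m)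
    descend {x} (acc below) Px with smaller? x
    ... | yes (y , Py , y≺x) = descend (below y≺x) Py
    ... | no  none           = x , Px , λ Py y≺x → none (_ , Py , y≺x)

_<ₗₑₓ₂_ : Rel (ℕ × ℕ) 0ℓ
_<ₗₑₓ₂_ = ×-Lex _≡_ _<_ _<_

_<ₗₑₓ_ : Rel (ℕ × ℕ × ℕ) 0ℓ
_<ₗₑₓ_ = ×-Lex _≡_ _<_ _<ₗₑₓ₂_

<ₗₑₓ-wellFounded : WellFounded _<ₗₑₓ_
<ₗₑₓ-wellFounded = ×-wellFounded <-wellFounded (×-wellFounded <-wellFounded <-wellFounded)

_<ₗₑₓ?_ : Decidable _<ₗₑₓ_
_<ₗₑₓ?_ = ×-decidable Nat._≟_ _<?_ (×-decidable Nat._≟_ _<?_ _<?_)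

≤-lex : ∀ {b ℓ} {B : Set b} {_≺_ : Rel B ℓ} {m m′ : ℕ} {u u′ : B} →
        m ≤ m′ → u ≺ u′ → ×-Lex _≡_ _<_ _≺_ (m , u) (m′ , u′)
≤-lex m≤m′ u≺u′ with m≤n⇒m<n∨m≡n m≤m′
... | inj₁ m<m′ = inj₁ m<m′
... | inj₂ m≡m′ = inj₂ (m≡m′ , u≺u′)

module _ (G : Graph n) where

  ∈N⁺ : adj G x y ≡ true → y ∈ N G x
  ∈N⁺ = ∈-tabulate⁺

  ∈N⁻ : y ∈ N G x → adj G x y ≡ true
  ∈N⁻ = ∈-tabulate⁻

  ∈N-sym : y ∈ N G x → x ∈ N G y
  ∈N-sym {y = y} {x} y∈Nx = ∈N⁺ (trans (Graph.sym G y x) (∈N⁻ y∈Nx))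

  ∈N⇒≢ : y ∈ N G x → y ≢ x
  ∈N⇒≢ {x = x} x∈Nx refl with () ← trans (sym (∈N⁻ x∈Nx)) (irrefl G x)

  ∈NS⁺ : x ∈ p → y ∈ N G x → y ∈ NS G p
  ∈NS⁺ {x = x} {p = p} x∈p y∈Nx =
    ∈-tabulate⁺ (anyᶠ⁺ _ x (cong₂ _∧_ ([]=⇒lookup x∈p) (∈N⁻ y∈Nx)))

  ∈NS⁻ : y ∈ NS G p → ∃ λ x → x ∈ p × y ∈ N G x
  ∈NS⁻ {p = p} y∈NSp with anyᶠ⁻ _ (∈-tabulate⁻ y∈NSp)
  ... | x , px∧xy = x , lookup⇒[]= x p (∧-conicalˡ _ _ px∧xy) , ∈N⁺ (∧-conicalʳ _ _ px∧xy)

  NS-mono : p ⊆ q → NS G p ⊆ NS G q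
  NS-mono p⊆q y∈NSp with ∈NS⁻ y∈NSp
  ... | x , x∈p , y∈Nx = ∈NS⁺ (p⊆q x∈p) y∈Nx

  NC≡∪ : ∀ p → NC G p ≡ p ∪ NS G p
  NC≡∪ p = trans (tabulate-∨ p (lookup (NS G p))) (cong (p ∪_) (tabulate∘lookup (NS G p)))

  ∈NC⁺ : x ∈ p ⊎ x ∈ NS G p → x ∈ NC G p
  ∈NC⁺ {p = p} = subst (_ ∈_) (sym (NC≡∪ p)) ∘ x∈p∪q⁺

  ∈NC⁻ : x ∈ NC G p → x ∈ p ⊎ x ∈ NS G p
  ∈NC⁻ {p = p} = x∈p∪q⁻ p (NS G p) ∘ subst (_ ∈_) (NC≡∪ p)

  x∉NC⇒x∉NS : x ∉ NC G p → x ∉ NS G p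
  x∉NC⇒x∉NS {p = p} x∉NC = x∉NC ∘ ∈NC⁺ {p = p} ∘ inj₂

  NC-mono : p ⊆ q → NC G p ⊆ NC G q
  NC-mono {p = p} {q = q} p⊆q x∈NCp with ∈NC⁻ x∈NCp
  ... | inj₁ x∈p   = ∈NC⁺ (inj₁ (p⊆q x∈p))
  ... | inj₂ x∈NSp = ∈NC⁺ {p = q} (inj₂ (NS-mono {p = p} {q = q} p⊆q x∈NSp))

  N─NC⊆EPN : ∀ p → N G x ─ NC G (p - x) ⊆ EPN G p x
  N─NC⊆EPN {x = x} p {y} y∈ = ∈-tabulate⁺ private-neighbour
    where
    y∈Nx : y ∈ N G x
    y∈Nx = p─q⊆p _ _ y∈
    y∉NC : y ∉ NC G (p - x)
    y∉NC = x∈p─q⇒x∉q _ _ y∈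
    y∉p : lookup p y ≡ false
    y∉p = ¬-not λ y∈p → y∉NC (∈NC⁺ {p = p - x} (inj₁ (x∈p∧x≢y⇒x∈p-y (lookup⇒[]= y p y∈p) (∈N⇒≢ y∈Nx))))
    other-neighbour : ∀ z → lookup p z ∧ not ⌊ z ≟ x ⌋ ∧ adj G z y ≡ true → z ∈ p - x × y ∈ N G z
    other-neighbour z h =
      x∈p∧x≢y⇒x∈p-y (lookup⇒[]= z p (∧-conicalˡ _ _ h)) (not⌊≟⌋⇒≢ (∧-conicalˡ _ _ h′)) ,
      ∈N⁺ (∧-conicalʳ _ _ h′)
      where h′ = ∧-conicalʳ (lookup p z) _ h
    no-other-neighbour : anyᶠ (λ z → lookup p z ∧ not ⌊ z ≟ x ⌋ ∧ adj G z y) ≡ false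
    no-other-neighbour = ¬-not λ h →
      let z , hz = anyᶠ⁻ (λ z → lookup p z ∧ not ⌊ z ≟ x ⌋ ∧ adj G z y) h
          z∈p-x , y∈Nz = other-neighbour z hz
      in y∉NC (∈NC⁺ {p = p - x} (inj₂ (∈NS⁺ {p = p - x} z∈p-x y∈Nz)))
    private-neighbour :
      adj G x y ∧ not (lookup p y) ∧ not (anyᶠ (λ z → lookup p z ∧ not ⌊ z ≟ x ⌋ ∧ adj G z y)) ≡ true
    private-neighbour = cong₂ _∧_ (∈N⁻ y∈Nx) (cong₂ _∧_ (cong not y∉p) (cong not no-other-neighbour))

  between1⁺ : ∀ m j → 1 ≤ m → m ≤ j → between1 G m j ≡ true
  between1⁺ (suc zero)    (suc j) _ _         = refl
  between1⁺ (suc (suc m)) (suc j) _ (s≤s m≤j) = between1⁺ (suc m) j (s≤s z≤n) m≤j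

  between1⁻ : ∀ m j → between1 G m j ≡ true → m ≤ j
  between1⁻ (suc zero)    (suc j) _ = s≤s z≤n
  between1⁻ (suc (suc m)) (suc j) h = s≤s (between1⁻ (suc m) j h)

  isolated : Subset n → Subset n
  isolated p = p ─ NS G p

  isolated⁺ : x ∈ p → x ∉ NS G (p - x) → x ∈ isolated p
  isolated⁺ {x = x} {p = p} x∈p x∉NS = x∈p∧x∉q⇒x∈p─q x∈p x∉NSp
    where
    x∉NSp : x ∉ NS G p
    x∉NSp x∈NSp with ∈NS⁻ x∈NSp
    ... | u , u∈p , x∈Nu = x∉NS (∈NS⁺ {p = p - x} (x∈p∧x≢y⇒x∈p-y u∈p (∈N⇒≢ (∈N-sym x∈Nu))) x∈Nu)

  isolated-exchange : x ∉ NS G (p - x) → isolated ((p - x) ∪ ⁅ y ⁆) ⊆ (isolated p - x) ∪ ⁅ y ⁆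
  isolated-exchange {x = x} {p = p} {y = y} x∉NS {z} z∈iso with x∈p∪q⁻ (p - x) ⁅ y ⁆ (p─q⊆p _ _ z∈iso)
  ... | inj₂ z∈⁅y⁆ = x∈p∪q⁺ (inj₂ z∈⁅y⁆)
  ... | inj₁ z∈p-x = x∈p∪q⁺ (inj₁ (x∈p∧x≢y⇒x∈p-y (x∈p∧x∉q⇒x∈p─q z∈p z∉NSp) z≢x))
    where
    z∈p : z ∈ p
    z∈p = p─q⊆p p ⁅ x ⁆ z∈p-x
    z≢x : z ≢ x
    z≢x = x∉⁅y⁆⇒x≢y (x∈p─q⇒x∉q p ⁅ x ⁆ z∈p-x)
    z∉NSp : z ∉ NS G p
    z∉NSp z∈NSp with ∈NS⁻ z∈NSp
    ... | u , u∈p , z∈Nu with u ≟ x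
    ...   | yes refl = x∉NS (∈NS⁺ {p = p - x} z∈p-x (∈N-sym z∈Nu))
    ...   | no  u≢x  = x∈p─q⇒x∉q _ (NS G ((p - x) ∪ ⁅ y ⁆)) z∈iso
                         (∈NS⁺ {p = (p - x) ∪ ⁅ y ⁆} (x∈p∪q⁺ (inj₁ (x∈p∧x≢y⇒x∈p-y u∈p u≢x))) z∈Nu)

module _ (G : Graph n) (k : ℕ) where

  propStep≡ : ∀ p → propStep G k p ≡
    p ∪ tabulate (λ y → anyᶠ (λ x → lookup p x ∧ adj G x y ∧ between1 G ∣ N G x ─ p ∣ k))
  propStep≡ p = tabulate-∨ p _

  propStep-inflationary : p ⊆ propStep G k p
  propStep-inflationary {p = p} = subst (_ ∈_) (sym (propStep≡ p)) ∘ x∈p∪q⁺ ∘ inj₁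

  ∈propStep⁺ : x ∈ p → y ∈ N G x → y ∉ p → ∣ N G x ─ p ∣ ≤ k → y ∈ propStep G k p
  ∈propStep⁺ {x = x} {p = p} {y = y} x∈p y∈Nx y∉p few =
    subst (y ∈_) (sym (propStep≡ p)) (x∈p∪q⁺ (inj₂ (∈-tabulate⁺ (anyᶠ⁺ _ x forcing))))
    where
    unobserved : 1 ≤ ∣ N G x ─ p ∣
    unobserved = ≤-<-trans z≤n (x∈p⇒∣p-x∣<∣p∣ (x∈p∧x∉q⇒x∈p─q y∈Nx y∉p))
    forcing : lookup p x ∧ adj G x y ∧ between1 G ∣ N G x ─ p ∣ k ≡ true
    forcing = cong₂ _∧_ ([]=⇒lookup x∈p) (cong₂ _∧_ (∈N⁻ G y∈Nx) (between1⁺ G _ k unobserved few))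

  ∈propStep⁻ : y ∈ propStep G k p → y ∈ p ⊎ ∃ λ x → x ∈ p × y ∈ N G x × ∣ N G x ─ p ∣ ≤ k
  ∈propStep⁻ {y = y} {p = p} y∈ with x∈p∪q⁻ p _ (subst (y ∈_) (propStep≡ p) y∈)
  ... | inj₁ y∈p = inj₁ y∈p
  ... | inj₂ y∈forced with anyᶠ⁻ _ (∈-tabulate⁻ y∈forced)
  ...   | x , forcing = inj₂ (x , lookup⇒[]= x p (∧-conicalˡ _ _ forcing) ,
                               ∈N⁺ G (∧-conicalˡ _ _ forcing′) ,
                               between1⁻ G _ k (∧-conicalʳ _ _ forcing′))
    where forcing′ = ∧-conicalʳ (lookup p x) _ forcing

  propStep-mono : p ⊆ q → propStep G k p ⊆ propStep G k q
  propStep-mono {p = p} {q = q} p⊆q {y} y∈ with ∈propStep⁻ y∈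
  ... | inj₁ y∈p = propStep-inflationary (p⊆q y∈p)
  ... | inj₂ (x , x∈p , y∈Nx , few) with y ∈? q
  ...   | yes y∈q = propStep-inflationary y∈q
  ...   | no  y∉q = ∈propStep⁺ (p⊆q x∈p) y∈Nx y∉q (≤-trans (q⊆r⇒∣p─r∣≤∣p─q∣ (N G x) p⊆q) few)

  powerDom-transfer : NC G p ⊆ propStep G k (NC G q) → IsPowerDom G k p → IsPowerDom G k q
  powerDom-transfer {p = p} {q = q} NCp⊆ (ℓ , full) =
    suc ℓ , ⊆-antisym ⊆⊤ (subst (_⊆ 𝒫 G k (suc ℓ) q) full (one-step-behind ℓ))
    where
    one-step-behind : ∀ i → 𝒫 G k i p ⊆ 𝒫 G k (suc i) q
    one-step-behind zero    = NCp⊆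
    one-step-behind (suc i) = propStep-mono (one-step-behind i)

  powerDom-mono : p ⊆ q → IsPowerDom G k p → IsPowerDom G k q
  powerDom-mono p⊆q = powerDom-transfer (propStep-inflationary ∘ NC-mono G p⊆q)

  powerDom-exchange : p ⊆ q ∪ ⁅ x ⁆ → x ∈ NC G q → ∣ N G x ─ NC G q ∣ ≤ k →
                      IsPowerDom G k p → IsPowerDom G k q
  powerDom-exchange {p = p} {q = q} {x = x} p⊆ x∈NCq few = powerDom-transfer NCp⊆
    where
    NCp⊆ : NC G p ⊆ propStep G k (NC G q)
    NCp⊆ {z} z∈NCp with ∈NC⁻ G z∈NCp
    ... | inj₁ z∈p with x∈p∪q⁻ q ⁅ x ⁆ (p⊆ z∈p)
    ...   | inj₁ z∈q = propStep-inflationary (∈NC⁺ G {p = q} (inj₁ z∈q))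
    ...   | inj₂ z∈⁅x⁆ with refl ← x∈⁅y⁆⇒x≡y x z∈⁅x⁆ = propStep-inflationary x∈NCq
    NCp⊆ {z} z∈NCp | inj₂ z∈NSp with ∈NS⁻ G z∈NSp
    ... | u , u∈p , z∈Nu with x∈p∪q⁻ q ⁅ x ⁆ (p⊆ u∈p) | z ∈? NC G q
    ...   | _          | yes z∈NCq = propStep-inflationary z∈NCq
    ...   | inj₁ u∈q   | no  _     = propStep-inflationary (∈NC⁺ G {p = q} (inj₂ (∈NS⁺ G u∈q z∈Nu)))
    ...   | inj₂ u∈⁅x⁆ | no  z∉NCq with refl ← x∈⁅y⁆⇒x≡y x u∈⁅x⁆ = ∈propStep⁺ x∈NCq z∈Nu z∉NCq few

  powerDom⇒𝒫n≡⊤ : IsPowerDom G k p → 𝒫 G k n p ≡ ⊤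
  powerDom⇒𝒫n≡⊤ {p = p} (ℓ , full) =
    IncreasingChain.⊤-by-step-n (λ i → 𝒫 G k i p) (λ _ → propStep-inflationary) (cong (propStep G k))
                                ℓ full

  powerDom? : ∀ p → Dec (IsPowerDom G k p)
  powerDom? p = map′ (n ,_) powerDom⇒𝒫n≡⊤ (≡-dec _≟ᵇ_ (𝒫 G k n p) ⊤)

  ⊤-powerDom : IsPowerDom G k ⊤
  ⊤-powerDom = 0 , ⊆-antisym ⊆⊤ (λ _ → ∈NC⁺ G {p = ⊤} (inj₁ ∈⊤))

  slide : Walk G x z → k + 2 ≤ deg G z → IsPowerDom G k (r ∪ ⁅ x ⁆) →
          ∃ λ y → k + 2 ≤ deg G y × IsPowerDom G k (r ∪ ⁅ y ⁆)
  slide here z-high pd = _ , z-high , pd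
  slide {x = x} {r = r} (step {v = x′} x~x′ walk) z-high pd with k + 2 ≤? deg G x
  ... | yes x-high = x , x-high , pd
  -- The token now on x′ observes x, and deg x ≤ k + 1 leaves x at most k unobserved neighbours.
  ... | no  x-low  = slide walk z-high (powerDom-exchange (p⊆q⇒p∪r⊆q∪r (p⊆p∪q ⁅ x′ ⁆)) x∈NC few pd)
    where
    x′∈r∪⁅x′⁆ : x′ ∈ r ∪ ⁅ x′ ⁆
    x′∈r∪⁅x′⁆ = x∈p∪q⁺ (inj₂ (x∈⁅x⁆ x′))
    x∈NC : x ∈ NC G (r ∪ ⁅ x′ ⁆)
    x∈NC = ∈NC⁺ G {p = r ∪ ⁅ x′ ⁆} (inj₂ (∈NS⁺ G x′∈r∪⁅x′⁆ (∈N-sym G (∈N⁺ G x~x′))))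
    few : ∣ N G x ─ NC G (r ∪ ⁅ x′ ⁆) ∣ ≤ k
    few = m<n<o+2⇒m≤o (p⊆q-x⇒∣p∣<∣q∣ (∈N⁺ G x~x′)
            (q⊆r⇒p─r⊆p─q (x∈p⇒⁅x⁆⊆p (∈NC⁺ G {p = r ∪ ⁅ x′ ⁆} (inj₁ x′∈r∪⁅x′⁆))))) (≰⇒> x-low)

  lowDegree : Subset n
  lowDegree = tabulate (λ x → ⌊ deg G x <? k + 2 ⌋)

  rank : Subset n → ℕ × ℕ × ℕ
  rank p = ∣ p ∣ , ∣ isolated G p ∣ , ∣ p ∩ lowDegree ∣

  SmallerPowerDom : Subset n → Set
  SmallerPowerDom p = ∃ λ q → IsPowerDom G k q × rank q <ₗₑₓ rank p

  smallerPowerDom? : ∀ p → Dec (SmallerPowerDom p)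
  smallerPowerDom? p = anySubset? (λ q → powerDom? q ×-dec (rank q <ₗₑₓ? rank p))

  rank-exchange-low-high : x ∈ p → x ∉ NS G (p - x) → deg G x < k + 2 → k + 2 ≤ deg G y →
                           rank ((p - x) ∪ ⁅ y ⁆) <ₗₑₓ rank p
  rank-exchange-low-high {x = x} {p = p} {y = y} x∈p x∉NS x-low y-high =
    ≤-lex {_≺_ = _<ₗₑₓ₂_} (p⊆q-x∪⁅y⁆⇒∣p∣≤∣q∣ x∈p ⊆-refl)
      (≤-lex {_≺_ = _<_}
        (p⊆q-x∪⁅y⁆⇒∣p∣≤∣q∣ (isolated⁺ G x∈p x∉NS) (isolated-exchange G {p = p} {y = y} x∉NS))
             (p⊆q-x⇒∣p∣<∣q∣ (x∈p∩q⁺ (x∈p , ∈-tabulate⁺ (⌊⌋-true⁺ (deg G x <? k + 2) x-low))) low⊆))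
    where
    low⊆ : ((p - x) ∪ ⁅ y ⁆) ∩ lowDegree ⊆ (p ∩ lowDegree) - x
    low⊆ z∈ with x∈p∩q⁻ _ _ z∈
    ... | z∈q , z-low with x∈p∪q⁻ (p - x) ⁅ y ⁆ z∈q
    ...   | inj₁ z∈p-x =
      x∈p∧x≢y⇒x∈p-y (x∈p∩q⁺ (p─q⊆p _ _ z∈p-x , z-low)) (x∉⁅y⁆⇒x≢y (x∈p─q⇒x∉q _ _ z∈p-x))
    ...   | inj₂ z∈⁅y⁆ with refl ← x∈⁅y⁆⇒x≡y y z∈⁅y⁆ =
      contradiction y-high (<⇒≱ (⌊⌋-true⁻ (deg G y <? k + 2) (∈-tabulate⁻ z-low)))

  module _ {p : Subset n} {x : Fin n} (p-pd : IsPowerDom G k p) (x∈p : x ∈ p)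
           (few : ∣ N G x ─ NC G (p - x) ∣ ≤ k) where

    remove-dominated : x ∈ NC G (p - x) → SmallerPowerDom p
    remove-dominated x∈NC = p - x , powerDom-exchange p⊆p-x∪⁅x⁆ x∈NC few p-pd , inj₁ (x∈p⇒∣p-x∣<∣p∣ x∈p)

    replace-by-neighbour : x ∉ NC G (p - x) → y ∈ N G x → y ∈ NC G (p - x) → SmallerPowerDom p
    replace-by-neighbour {y = y} x∉NC y∈Nx y∈NC =
      p′ , p′-pd , ≤-lex {_≺_ = _<ₗₑₓ₂_} (p⊆q-x∪⁅y⁆⇒∣p∣≤∣q∣ x∈p ⊆-refl)
                     (inj₁ (p⊆q-x⇒∣p∣<∣q∣ (isolated⁺ G x∈p x∉NS) isolated-p′⊆))
      where
      p′ : Subset n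
      p′ = (p - x) ∪ ⁅ y ⁆
      x∉NS : x ∉ NS G (p - x)
      x∉NS = x∉NC⇒x∉NS G {p = p - x} x∉NC
      p-x⊆p′ : p - x ⊆ p′
      p-x⊆p′ = p⊆p∪q ⁅ y ⁆
      y∈p′ : y ∈ p′
      y∈p′ = x∈p∪q⁺ (inj₂ (x∈⁅x⁆ y))
      p′-pd : IsPowerDom G k p′
      p′-pd = powerDom-exchange (⊆-trans p⊆p-x∪⁅x⁆ (p⊆q⇒p∪r⊆q∪r p-x⊆p′))
               (∈NC⁺ G {p = p′} (inj₂ (∈NS⁺ G y∈p′ (∈N-sym G y∈Nx))))
               (≤-trans (q⊆r⇒∣p─r∣≤∣p─q∣ (N G x) (NC-mono G p-x⊆p′)) few) p-pd
      y∈NSp′ : y ∈ NS G p′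
      y∈NSp′ with ∈NC⁻ G y∈NC
      ... | inj₁ y∈p-x = contradiction (∈NS⁺ G {p = p - x} y∈p-x (∈N-sym G y∈Nx)) x∉NS
      ... | inj₂ y∈NS  = NS-mono G {p = p - x} {q = p′} p-x⊆p′ y∈NS
      isolated-p′⊆ : isolated G p′ ⊆ isolated G p - x
      isolated-p′⊆ z∈iso with x∈p∪q⁻ _ _ (isolated-exchange G x∉NS z∈iso)
      ... | inj₁ z∈ = z∈
      ... | inj₂ z∈⁅y⁆ with refl ← x∈⁅y⁆⇒x≡y y z∈⁅y⁆ = contradiction y∈NSp′ (x∈p─q⇒x∉q p′ _ z∈iso)

    slide-to-high-degree : Connected G → MaxDegAtLeast G (k + 2) → x ∉ NC G (p - x) →
                           (∀ {y} → y ∈ N G x → y ∉ NC G (p - x)) → SmallerPowerDom p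
    slide-to-high-degree connected (w , w-high) x∉NC N-unobserved
      with slide (connected x w) w-high (powerDom-mono p⊆p-x∪⁅x⁆ p-pd)
    ... | y , y-high , p′-pd =
      _ , p′-pd , rank-exchange-low-high x∈p (x∉NC⇒x∉NS G {p = p - x} x∉NC) x-low y-high
      where
      x-low : deg G x < k + 2
      x-low = ≤-<-trans (≤-trans (p⊆q⇒∣p∣≤∣q∣ (λ y∈Nx → x∈p∧x∉q⇒x∈p─q y∈Nx (N-unobserved y∈Nx))) few)
                        (m<m+n k (s≤s z≤n))

  improve : Connected G → MaxDegAtLeast G (k + 2) → IsPowerDom G k p → x ∈ p →
            ∣ EPN G p x ∣ ≤ k → SmallerPowerDom p
  improve {p = p} {x = x} connected high p-pd x∈p few-private =
    by-cases (x ∈? NC G (p - x)) (nonempty? (N G x ∩ NC G (p - x)))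
    where
    few : ∣ N G x ─ NC G (p - x) ∣ ≤ k
    few = ≤-trans (p⊆q⇒∣p∣≤∣q∣ (N─NC⊆EPN G p)) few-private
    by-cases : Dec (x ∈ NC G (p - x)) → Dec (Nonempty (N G x ∩ NC G (p - x))) → SmallerPowerDom p
    by-cases (yes x∈NC) _              = remove-dominated p-pd x∈p few x∈NC
    by-cases (no  x∉NC) (yes (y , y∈)) = replace-by-neighbour p-pd x∈p few x∉NC
                                           (proj₁ (x∈p∩q⁻ (N G x) _ y∈)) (proj₂ (x∈p∩q⁻ (N G x) _ y∈))
    by-cases (no  x∉NC) (no  none)     = slide-to-high-degree p-pd x∈p few connected high x∉NC
                                           (λ y∈Nx y∈NC → none (_ , x∈p∩q⁺ (y∈Nx , y∈NC)))

lemma5p2 : (k n : ℕ) (G : Graph n) → Connected G → MaxDegAtLeast G (k + 2) →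
    ∃ λ (S : Subset n) → IsMinPowerDom G k S ×
      (∀ v → v ∈ S → k + 1 ≤ ∣ EPN G S v ∣)
lemma5p2 k n G connected high
  with ≺-minimal (On.wellFounded (rank G k) <ₗₑₓ-wellFounded) (smallerPowerDom? G k) (⊤-powerDom G k)
... | S , S-pd , S-least = S , (S-pd , S-minimum) , S-private
  where
  S-minimum : ∀ T → IsPowerDom G k T → ∣ S ∣ ≤ ∣ T ∣
  S-minimum T T-pd = ≮⇒≥ λ ∣T∣<∣S∣ → S-least T-pd (inj₁ ∣T∣<∣S∣)
  S-private : ∀ v → v ∈ S → k + 1 ≤ ∣ EPN G S v ∣
  S-private v v∈S = ≮⇒≥ λ ∣EPN∣<k+1 →
    let T , T-pd , T≺S = improve G k connected high S-pd v∈S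
                           (m<1+n⇒m≤n (subst (∣ EPN G S v ∣ <_) (+-comm k 1) ∣EPN∣<k+1))
    in S-least T-pd T≺S
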